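{- For every non-negative integer $n$, \[ (x+1)\sum_{k=0}^{n}\binom{n}{k}{}_{H}w_{n-k}(x)\,w_{k}(x)={}_{H}w_{n+1}(x)+{}_{H}w_{n}(x)-w_{n+1}(x). \]
   Context: $\left\{ {n \atop k}\right\}$ denotes the Stirling number of the second kind. $H_k=\sum_{i=1}^k 1/i$ is the $k$-th harmonic number. The geometric polynomials are $w_m(x)=\sum_{k=0}^{m}\left\{ {m \atop k}\right\} k!\,x^k$ (so $w_0=1$), and the harmonic geometric polynomials are ${}_{H}w_m(x)=\sum_{k=1}^{m}\left\{ {m \atop k}\right\} k!\,H_k\,x^k$ (so ${}_{H}w_0=0$). -}

module Defs where

open import Data.Nat as ℕ using (ℕ; zero; suc; _∸_)
open import Data.Nat.Combinatorics using (_C_)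
open import Data.Integer using (+_)
open import Data.Rational using (ℚ; 0ℚ; 1ℚ; _+_; _*_; _-_; _/_)

stirling2 : ℕ → ℕ → ℕ
stirling2 zero    zero    = 1
stirling2 zero    (suc k) = 0
stirling2 (suc n) zero    = 0
stirling2 (suc n) (suc k) = suc k ℕ.* stirling2 n (suc k) ℕ.+ stirling2 n k

ℕ→ℚ : ℕ → ℚ
ℕ→ℚ n = (+ n) / 1

harmonic : ℕ → ℚ
harmonic zero    = 0ℚ
harmonic (suc k) = harmonic k + ((+ 1) / suc k)

_^_ : ℚ → ℕ → ℚ
x ^ zero  = 1ℚ
x ^ suc k = x * (x ^ k)

sumTo : ℕ → (ℕ → ℚ) → ℚ
sumTo zero    f = f 0
sumTo (suc n) f = sumTo n f + f (suc n)

sumFrom1 : ℕ → (ℕ → ℚ) → ℚ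
sumFrom1 zero    f = 0ℚ
sumFrom1 (suc n) f = sumFrom1 n f + f (suc n)

w : ℕ → ℚ → ℚ
w m x = sumTo m (λ k → ℕ→ℚ (stirling2 m k ℕ.* (k ℕ.!)) * (x ^ k))

Hw : ℕ → ℚ → ℚ
Hw m x = sumFrom1 m (λ k → ℕ→ℚ (stirling2 m k ℕ.* (k ℕ.!)) * harmonic k * (x ^ k))

{-# OPTIONS --safe #-}

-- Write geometric x n a = Σ_j S(n,j) j! a_j x^j for a coefficient sequence a, so that
-- w_n = geometric x n 1 and Hw_n = geometric x n H.  Reading a as the power series
-- Σ_j a_j y^j, the Stirling recurrence becomes
--   geometric x (n+1) a = geometric x n (θ a) + x · geometric x n (∂ a),
-- with ∂ the formal derivative and θ = y∂.  Both are derivations of the Cauchy product ⋆,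
-- so induction on n gives the binomial convolution formula
--   Σ_k C(n,k) · geometric x (n-k) a · geometric x k b = geometric x n (a ⋆ b),
-- i.e. multiplicativity of a ↦ Σ_n geometric x n a · tⁿ/n! = a(x(eᵗ - 1)).
-- For a = H and b = 1 the product is c_j = H_0 + … + H_j, and the identities
-- (j+1) H_j = c_j + j and (j+1) H_(j+1) = c_j + (j+1) turn Hw_(n+1) + Hw_n - w_(n+1)
-- into (x+1) · geometric x n c.

module Submission where

open import Defs
open import Data.Nat using (ℕ; suc; _∸_)
open import Data.Nat.Combinatorics using (_C_)
open import Data.Rational using (ℚ; 1ℚ; _+_; _*_; _-_)
open import Relation.Binary.PropositionalEquality using (_≡_)

open import Algebra.Bundles using (CommutativeMonoid)
import Data.Integer as ℤ
import Data.Integer.Properties as ℤ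
open import Data.Nat as ℕ using (zero; _≤_; _<_; z≤n; s≤s; _!)
open import Data.Nat.Combinatorics using (k>n⇒nCk≡0; nCk+nC[k+1]≡[n+1]C[k+1])
open import Data.Nat.Coprimality using (1-coprimeTo) renaming (sym to coprime-sym)
import Data.Nat.Properties as ℕ
import Data.Nat.Solver as ℕ-Solver
open import Data.Rational using (0ℚ; mkℚ; _/_; 1/_)
open import Data.Rational.Properties
open import Data.Rational.Solver using (module +-*-Solver)
open import Data.Rational.Unnormalised as ℚᵘ using (*≡*)
import Data.Rational.Unnormalised.Properties as ℚᵘ
open import Function using (const)
open import Relation.Binary.PropositionalEquality using (refl; sym; trans; cong; cong₂; module ≡-Reasoning)

open import Algebra.Properties.CommutativeSemigroup (CommutativeMonoid.commutativeSemigroup +-0-commutativeMonoid)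
  using () renaming (interchange to +-interchange)
open +-*-Solver
open ≡-Reasoning

-- ℕ→ℚ n is stuck on a gcd for variable n; fromℕ n is the same rational in normal form.
fromℕ : ℕ → ℚ
fromℕ n = mkℚ (ℤ.+ n) 0 (coprime-sym (1-coprimeTo n))

ℕ→ℚ≡fromℕ : ∀ n → ℕ→ℚ n ≡ fromℕ n
ℕ→ℚ≡fromℕ n = ↥p/↧p≡p (fromℕ n)

fromℕ-+ : ∀ m n → fromℕ (m ℕ.+ n) ≡ fromℕ m + fromℕ n
fromℕ-+ m n = toℚᵘ-injective (ℚᵘ.≃-sym (ℚᵘ.≃-trans (toℚᵘ-homo-+ (fromℕ m) (fromℕ n)) (*≡* eq)))
  where
  eq : (ℤ.+ m ℤ.* ℤ.+ 1 ℤ.+ ℤ.+ n ℤ.* ℤ.+ 1) ℤ.* ℤ.+ 1 ≡ ℤ.+ (m ℕ.+ n) ℤ.* (ℤ.+ 1 ℤ.* ℤ.+ 1)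
  eq rewrite ℤ.*-identityʳ (ℤ.+ m) | ℤ.*-identityʳ (ℤ.+ n) = refl

fromℕ-* : ∀ m n → fromℕ (m ℕ.* n) ≡ fromℕ m * fromℕ n
fromℕ-* m n = toℚᵘ-injective (ℚᵘ.≃-sym (ℚᵘ.≃-trans (toℚᵘ-homo-* (fromℕ m) (fromℕ n)) (*≡* eq)))
  where
  eq : (ℤ.+ m ℤ.* ℤ.+ n) ℤ.* ℤ.+ 1 ≡ ℤ.+ (m ℕ.* n) ℤ.* (ℤ.+ 1 ℤ.* ℤ.+ 1)
  eq = cong (ℤ._* ℤ.+ 1) (sym (ℤ.pos-* m n))

ℕ→ℚ-+ : ∀ m n → ℕ→ℚ (m ℕ.+ n) ≡ ℕ→ℚ m + ℕ→ℚ n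
ℕ→ℚ-+ m n rewrite ℕ→ℚ≡fromℕ (m ℕ.+ n) | ℕ→ℚ≡fromℕ m | ℕ→ℚ≡fromℕ n = fromℕ-+ m n

ℕ→ℚ-* : ∀ m n → ℕ→ℚ (m ℕ.* n) ≡ ℕ→ℚ m * ℕ→ℚ n
ℕ→ℚ-* m n rewrite ℕ→ℚ≡fromℕ (m ℕ.* n) | ℕ→ℚ≡fromℕ m | ℕ→ℚ≡fromℕ n = fromℕ-* m n

ℕ→ℚ-∸ : ∀ {i j} → i ≤ j → ℕ→ℚ j ≡ ℕ→ℚ i + ℕ→ℚ (j ∸ i)
ℕ→ℚ-∸ {i} {j} i≤j = trans (cong ℕ→ℚ (sym (ℕ.m+[n∸m]≡n i≤j))) (ℕ→ℚ-+ i (j ∸ i))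

ℕ→ℚ[1+n]*1/[1+n]≡1 : ∀ n → ℕ→ℚ (suc n) * ((ℤ.+ 1) / suc n) ≡ 1ℚ
ℕ→ℚ[1+n]*1/[1+n]≡1 n = trans (cong₂ _*_ (ℕ→ℚ≡fromℕ (suc n)) (↥p/↧p≡p (1/ fromℕ (suc n))))
                              (*-inverseʳ (fromℕ (suc n)))

sumTo-cong : ∀ n {f g : ℕ → ℚ} → (∀ k → k ≤ n → f k ≡ g k) → sumTo n f ≡ sumTo n g
sumTo-cong zero    f≗g = f≗g 0 z≤n
sumTo-cong (suc n) f≗g =
  cong₂ _+_ (sumTo-cong n (λ k k≤n → f≗g k (ℕ.m≤n⇒m≤1+n k≤n))) (f≗g (suc n) ℕ.≤-refl)

sumTo-+ : ∀ n (f g : ℕ → ℚ) → sumTo n (λ k → f k + g k) ≡ sumTo n f + sumTo n g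
sumTo-+ zero    f g = refl
sumTo-+ (suc n) f g = trans (cong (_+ (f (suc n) + g (suc n))) (sumTo-+ n f g))
                            (+-interchange (sumTo n f) (sumTo n g) (f (suc n)) (g (suc n)))

*-distribˡ-sumTo : ∀ n c (f : ℕ → ℚ) → c * sumTo n f ≡ sumTo n (λ k → c * f k)
*-distribˡ-sumTo zero    c f = refl
*-distribˡ-sumTo (suc n) c f =
  trans (*-distribˡ-+ c (sumTo n f) (f (suc n))) (cong (_+ c * f (suc n)) (*-distribˡ-sumTo n c f))

sumTo-+-* : ∀ n c (f g : ℕ → ℚ) → sumTo n (λ k → f k + c * g k) ≡ sumTo n f + c * sumTo n g
sumTo-+-* n c f g = trans (sumTo-+ n f (λ k → c * g k)) (cong (sumTo n f +_) (sym (*-distribˡ-sumTo n c g)))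

sumTo-suc : ∀ n (f : ℕ → ℚ) → sumTo (suc n) f ≡ f 0 + sumTo n (λ k → f (suc k))
sumTo-suc zero    f = refl
sumTo-suc (suc n) f = trans (cong (_+ f (suc (suc n))) (sumTo-suc n f))
                            (+-assoc (f 0) (sumTo n (λ k → f (suc k))) (f (suc (suc n))))

sumTo-tail : ∀ n {f : ℕ → ℚ} → f 0 ≡ 0ℚ → sumTo (suc n) f ≡ sumTo n (λ k → f (suc k))
sumTo-tail n {f} f0≡0 = trans (sumTo-suc n f) (trans (cong (_+ tail) f0≡0) (+-identityˡ tail))
  where
  tail : ℚ
  tail = sumTo n (λ k → f (suc k))

sumTo-init : ∀ n {f : ℕ → ℚ} → f (suc n) ≡ 0ℚ → sumTo (suc n) f ≡ sumTo n f
sumTo-init n {f} f[1+n]≡0 = trans (cong (sumTo n f +_) f[1+n]≡0) (+-identityʳ (sumTo n f))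

sumTo≡sumFrom1 : ∀ n {f : ℕ → ℚ} → f 0 ≡ 0ℚ → sumTo n f ≡ sumFrom1 n f
sumTo≡sumFrom1 zero    f0≡0 = f0≡0
sumTo≡sumFrom1 (suc n) {f} f0≡0 = cong (_+ f (suc n)) (sumTo≡sumFrom1 n f0≡0)

sumTo-pascal : ∀ n (g : ℕ → ℚ) →
  sumTo (suc n) (λ k → ℕ→ℚ (suc n C k) * g k) ≡ sumTo n (λ k → ℕ→ℚ (n C k) * (g k + g (suc k)))
sumTo-pascal n g = begin
    sumTo (suc n) (λ k → ℕ→ℚ (suc n C k) * g k)
  ≡⟨ sumTo-suc n _ ⟩
    unshifted 0 + sumTo n (λ k → ℕ→ℚ (suc n C suc k) * g (suc k))
  ≡⟨ cong (unshifted 0 +_) (trans (sumTo-cong n (λ k _ → pascal k)) (sumTo-+ n _ _)) ⟩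
    unshifted 0 + (sumTo n shifted + sumTo n (λ k → ℕ→ℚ (n C suc k) * g (suc k)))
  ≡⟨ x+[y+z]≡y+[x+z] (unshifted 0) (sumTo n shifted) _ ⟩
    sumTo n shifted + (unshifted 0 + sumTo n (λ k → ℕ→ℚ (n C suc k) * g (suc k)))
  ≡⟨ cong (sumTo n shifted +_) (trans (sym (sumTo-suc n unshifted)) (sumTo-init n nC[1+n]≡0)) ⟩
    sumTo n shifted + sumTo n unshifted
  ≡⟨ trans (+-comm (sumTo n shifted) (sumTo n unshifted)) (sym (sumTo-+ n unshifted shifted)) ⟩
    sumTo n (λ k → unshifted k + shifted k)
  ≡⟨ sumTo-cong n (λ k _ → sym (*-distribˡ-+ (ℕ→ℚ (n C k)) (g k) (g (suc k)))) ⟩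
    sumTo n (λ k → ℕ→ℚ (n C k) * (g k + g (suc k)))
  ∎
  where
  unshifted shifted : ℕ → ℚ
  unshifted k = ℕ→ℚ (n C k) * g k
  shifted   k = ℕ→ℚ (n C k) * g (suc k)
  pascal : ∀ k → ℕ→ℚ (suc n C suc k) * g (suc k) ≡ shifted k + ℕ→ℚ (n C suc k) * g (suc k)
  pascal k = begin
      ℕ→ℚ (suc n C suc k) * g (suc k)
    ≡⟨ cong (λ c → ℕ→ℚ c * g (suc k)) (sym (nCk+nC[k+1]≡[n+1]C[k+1] n k)) ⟩
      ℕ→ℚ (n C k ℕ.+ n C suc k) * g (suc k)
    ≡⟨ cong (_* g (suc k)) (ℕ→ℚ-+ (n C k) (n C suc k)) ⟩
      (ℕ→ℚ (n C k) + ℕ→ℚ (n C suc k)) * g (suc k)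
    ≡⟨ *-distribʳ-+ (g (suc k)) (ℕ→ℚ (n C k)) (ℕ→ℚ (n C suc k)) ⟩
      shifted k + ℕ→ℚ (n C suc k) * g (suc k)
    ∎
  nC[1+n]≡0 : unshifted (suc n) ≡ 0ℚ
  nC[1+n]≡0 = trans (cong (λ c → ℕ→ℚ c * g (suc n)) (k>n⇒nCk≡0 (ℕ.n<1+n n))) (*-zeroˡ (g (suc n)))
  x+[y+z]≡y+[x+z] : ∀ a b c → a + (b + c) ≡ b + (a + c)
  x+[y+z]≡y+[x+z] = solve 3 (λ a b c → a :+ (b :+ c) := b :+ (a :+ c)) refl

stirling2-vanish : ∀ {n k} → n < k → stirling2 n k ≡ 0
stirling2-vanish {zero}  {suc k} _ = refl
stirling2-vanish {suc n} {suc k} (s≤s n<k) = begin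
    suc k ℕ.* stirling2 n (suc k) ℕ.+ stirling2 n k
  ≡⟨ cong₂ (λ s₁ s₀ → suc k ℕ.* s₁ ℕ.+ s₀)
          (stirling2-vanish (ℕ.m<n⇒m<1+n n<k)) (stirling2-vanish n<k) ⟩
    suc k ℕ.* 0 ℕ.+ 0
  ≡⟨ cong (ℕ._+ 0) (ℕ.*-zeroʳ (suc k)) ⟩
    0
  ∎

surj : ℕ → ℕ → ℚ
surj n j = ℕ→ℚ (stirling2 n j ℕ.* j !)

surj-vanish : ∀ n → surj n (suc n) ≡ 0ℚ
surj-vanish n rewrite stirling2-vanish (ℕ.n<1+n n) = refl

surj-suc : ∀ n j → surj (suc n) (suc j) ≡ ℕ→ℚ (suc j) * surj n (suc j) + ℕ→ℚ (suc j) * surj n j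
surj-suc n j = begin
    ℕ→ℚ (stirling2 (suc n) (suc j) ℕ.* suc j !)
  ≡⟨ cong ℕ→ℚ (reassociate (suc j) (stirling2 n (suc j)) (stirling2 n j) (j !)) ⟩
    ℕ→ℚ (suc j ℕ.* (stirling2 n (suc j) ℕ.* suc j !) ℕ.+ suc j ℕ.* (stirling2 n j ℕ.* j !))
  ≡⟨ ℕ→ℚ-+ (suc j ℕ.* (stirling2 n (suc j) ℕ.* suc j !)) (suc j ℕ.* (stirling2 n j ℕ.* j !)) ⟩
    ℕ→ℚ (suc j ℕ.* (stirling2 n (suc j) ℕ.* suc j !)) + ℕ→ℚ (suc j ℕ.* (stirling2 n j ℕ.* j !))
  ≡⟨ cong₂ _+_ (ℕ→ℚ-* (suc j) (stirling2 n (suc j) ℕ.* suc j !))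
               (ℕ→ℚ-* (suc j) (stirling2 n j ℕ.* j !)) ⟩
    ℕ→ℚ (suc j) * surj n (suc j) + ℕ→ℚ (suc j) * surj n j
  ∎
  where
  open ℕ-Solver.+-*-Solver using () renaming (solve to ℕ-solve; _:+_ to _⊕_; _:*_ to _⊗_; _:=_ to _≐_)
  reassociate : ∀ a s₁ s₀ f →
    (a ℕ.* s₁ ℕ.+ s₀) ℕ.* (a ℕ.* f) ≡ a ℕ.* (s₁ ℕ.* (a ℕ.* f)) ℕ.+ a ℕ.* (s₀ ℕ.* f)
  reassociate = ℕ-solve 4
    (λ a s₁ s₀ f → (a ⊗ s₁ ⊕ s₀) ⊗ (a ⊗ f) ≐ a ⊗ (s₁ ⊗ (a ⊗ f)) ⊕ a ⊗ (s₀ ⊗ f)) refl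

Seq : Set
Seq = ℕ → ℚ

infixl 7 _⋆_
infixl 6 _⊕_

_⊕_ : Seq → Seq → Seq
(a ⊕ b) j = a j + b j

_⋆_ : Seq → Seq → Seq
(a ⋆ b) j = sumTo j (λ i → a i * b (j ∸ i))

θ ∂ : Seq → Seq
θ a j = ℕ→ℚ j * a j
∂ a j = ℕ→ℚ (suc j) * a (suc j)

θ-⋆ : ∀ a b j → θ (a ⋆ b) j ≡ (θ a ⋆ b ⊕ a ⋆ θ b) j
θ-⋆ a b j = begin
    ℕ→ℚ j * (a ⋆ b) j
  ≡⟨ *-distribˡ-sumTo j (ℕ→ℚ j) (λ i → a i * b (j ∸ i)) ⟩
    sumTo j (λ i → ℕ→ℚ j * (a i * b (j ∸ i)))
  ≡⟨ sumTo-cong j split ⟩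
    sumTo j (λ i → θ a i * b (j ∸ i) + a i * θ b (j ∸ i))
  ≡⟨ sumTo-+ j (λ i → θ a i * b (j ∸ i)) (λ i → a i * θ b (j ∸ i)) ⟩
    (θ a ⋆ b ⊕ a ⋆ θ b) j
  ∎
  where
  distribute : ∀ m n u v → (m + n) * (u * v) ≡ m * u * v + u * (n * v)
  distribute = solve 4 (λ m n u v → (m :+ n) :* (u :* v) := m :* u :* v :+ u :* (n :* v)) refl
  split : ∀ i → i ≤ j → ℕ→ℚ j * (a i * b (j ∸ i)) ≡ θ a i * b (j ∸ i) + a i * θ b (j ∸ i)
  split i i≤j = trans (cong (_* (a i * b (j ∸ i))) (ℕ→ℚ-∸ i≤j))
                      (distribute (ℕ→ℚ i) (ℕ→ℚ (j ∸ i)) (a i) (b (j ∸ i)))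

θ⋆-suc : ∀ a b j → (θ a ⋆ b) (suc j) ≡ (∂ a ⋆ b) j
θ⋆-suc a b j = sumTo-tail j (trans (cong (_* b (suc j)) (*-zeroˡ (a 0))) (*-zeroˡ (b (suc j))))

⋆θ-suc : ∀ a b j → (a ⋆ θ b) (suc j) ≡ (a ⋆ ∂ b) j
⋆θ-suc a b j = trans (sumTo-init j last≡0)
                     (sumTo-cong j (λ i i≤j → cong (λ m → a i * θ b m) (ℕ.+-∸-assoc 1 i≤j)))
  where
  last≡0 : a (suc j) * θ b (j ∸ j) ≡ 0ℚ
  last≡0 = trans (cong (λ m → a (suc j) * θ b m) (ℕ.n∸n≡0 j))
                 (trans (cong (a (suc j) *_) (*-zeroˡ (b 0))) (*-zeroʳ (a (suc j))))

-- ∂ c j is θ c (suc j) by definition.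
∂-⋆ : ∀ a b j → ∂ (a ⋆ b) j ≡ (∂ a ⋆ b ⊕ a ⋆ ∂ b) j
∂-⋆ a b j = trans (θ-⋆ a b (suc j)) (cong₂ _+_ (θ⋆-suc a b j) (⋆θ-suc a b j))

module _ (x : ℚ) where

  geometric : ℕ → Seq → ℚ
  geometric n a = sumTo n (λ j → surj n j * a j * x ^ j)

  geometric-cong : ∀ n {a b} → (∀ j → a j ≡ b j) → geometric n a ≡ geometric n b
  geometric-cong n a≗b = sumTo-cong n (λ j _ → cong (λ t → surj n j * t * x ^ j) (a≗b j))

  geometric-⊕ : ∀ n a b → geometric n (a ⊕ b) ≡ geometric n a + geometric n b
  geometric-⊕ n a b = trans (sumTo-cong n (λ j _ → distribute (surj n j) (a j) (b j) (x ^ j)))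
                            (sumTo-+ n (λ j → surj n j * a j * x ^ j) (λ j → surj n j * b j * x ^ j))
    where
    distribute : ∀ s u v p → s * (u + v) * p ≡ s * u * p + s * v * p
    distribute = solve 4 (λ s u v p → s :* (u :+ v) :* p := s :* u :* p :+ s :* v :* p) refl

  geometric-suc : ∀ n a → geometric (suc n) a ≡ geometric n (θ a) + x * geometric n (∂ a)
  geometric-suc n a = begin
      geometric (suc n) a
    ≡⟨ sumTo-tail n (trans (cong (_* 1ℚ) (*-zeroˡ (a 0))) (*-zeroˡ 1ℚ)) ⟩
      sumTo n (λ j → surj (suc n) (suc j) * a (suc j) * x ^ suc j)
    ≡⟨ sumTo-cong n (λ j _ → stirling-step j) ⟩
      sumTo n (λ j → θ-term (suc j) + x * ∂-term j)
    ≡⟨ sumTo-+-* n x (λ j → θ-term (suc j)) ∂-term ⟩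
      sumTo n (λ j → θ-term (suc j)) + x * geometric n (∂ a)
    ≡⟨ cong (_+ x * geometric n (∂ a)) (trans (sym (sumTo-tail n θ-term[0]≡0)) (sumTo-init n θ-term[1+n]≡0)) ⟩
      geometric n (θ a) + x * geometric n (∂ a)
    ∎
    where
    θ-term ∂-term : ℕ → ℚ
    θ-term j = surj n j * θ a j * x ^ j
    ∂-term j = surj n j * ∂ a j * x ^ j
    θ-term[0]≡0 : θ-term 0 ≡ 0ℚ
    θ-term[0]≡0 = trans (cong (λ t → surj n 0 * t * 1ℚ) (*-zeroˡ (a 0)))
                        (trans (cong (_* 1ℚ) (*-zeroʳ (surj n 0))) (*-zeroˡ 1ℚ))
    θ-term[1+n]≡0 : θ-term (suc n) ≡ 0ℚ
    θ-term[1+n]≡0 = trans (cong (λ s → s * θ a (suc n) * x ^ suc n) (surj-vanish n))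
                          (trans (cong (_* x ^ suc n) (*-zeroˡ (θ a (suc n)))) (*-zeroˡ (x ^ suc n)))
    regroup : ∀ m s₁ s₀ u y p →
      (m * s₁ + m * s₀) * u * (y * p) ≡ s₁ * (m * u) * (y * p) + y * (s₀ * (m * u) * p)
    regroup = solve 6 (λ m s₁ s₀ u y p → (m :* s₁ :+ m :* s₀) :* u :* (y :* p)
                        := s₁ :* (m :* u) :* (y :* p) :+ y :* (s₀ :* (m :* u) :* p)) refl
    stirling-step : ∀ j → surj (suc n) (suc j) * a (suc j) * x ^ suc j ≡ θ-term (suc j) + x * ∂-term j
    stirling-step j = trans (cong (λ s → s * a (suc j) * x ^ suc j) (surj-suc n j))
                            (regroup (ℕ→ℚ (suc j)) (surj n (suc j)) (surj n j) (a (suc j)) x (x ^ j))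

  binomialConvolution : ℕ → Seq → Seq → ℚ
  binomialConvolution n a b = sumTo n (λ k → ℕ→ℚ (n C k) * geometric (n ∸ k) a * geometric k b)

  binomialConvolution-suc : ∀ n a b → binomialConvolution (suc n) a b
    ≡ (binomialConvolution n (θ a) b + x * binomialConvolution n (∂ a) b)
    + (binomialConvolution n a (θ b) + x * binomialConvolution n a (∂ b))
  binomialConvolution-suc n a b = begin
      binomialConvolution (suc n) a b
    ≡⟨ sumTo-cong (suc n) (λ k _ → *-assoc (ℕ→ℚ (suc n C k)) (geometric (suc n ∸ k) a) (geometric k b)) ⟩
      sumTo (suc n) (λ k → ℕ→ℚ (suc n C k) * product k)
    ≡⟨ sumTo-pascal n product ⟩
      sumTo n (λ k → ℕ→ℚ (n C k) * (product k + product (suc k)))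
    ≡⟨ sumTo-cong n expand ⟩
      sumTo n (λ k → (θ-term k + x * ∂-term k) + (term-θ k + x * term-∂ k))
    ≡⟨ sumTo-+ n (λ k → θ-term k + x * ∂-term k) (λ k → term-θ k + x * term-∂ k) ⟩
      sumTo n (λ k → θ-term k + x * ∂-term k) + sumTo n (λ k → term-θ k + x * term-∂ k)
    ≡⟨ cong₂ _+_ (sumTo-+-* n x θ-term ∂-term) (sumTo-+-* n x term-θ term-∂) ⟩
      (binomialConvolution n (θ a) b + x * binomialConvolution n (∂ a) b)
        + (binomialConvolution n a (θ b) + x * binomialConvolution n a (∂ b))
    ∎
    where
    product : ℕ → ℚ
    product k = geometric (suc n ∸ k) a * geometric k b
    θ-term ∂-term term-θ term-∂ : ℕ → ℚ
    θ-term k = ℕ→ℚ (n C k) * geometric (n ∸ k) (θ a) * geometric k b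
    ∂-term k = ℕ→ℚ (n C k) * geometric (n ∸ k) (∂ a) * geometric k b
    term-θ k = ℕ→ℚ (n C k) * geometric (n ∸ k) a * geometric k (θ b)
    term-∂ k = ℕ→ℚ (n C k) * geometric (n ∸ k) a * geometric k (∂ b)
    distribute : ∀ y c pθ p∂ q p qθ q∂ → c * ((pθ + y * p∂) * q + p * (qθ + y * q∂))
               ≡ (c * pθ * q + y * (c * p∂ * q)) + (c * p * qθ + y * (c * p * q∂))
    distribute = solve 8 (λ y c pθ p∂ q p qθ q∂ → c :* ((pθ :+ y :* p∂) :* q :+ p :* (qθ :+ y :* q∂))
               := (c :* pθ :* q :+ y :* (c :* p∂ :* q)) :+ (c :* p :* qθ :+ y :* (c :* p :* q∂))) refl
    expand : ∀ k → k ≤ n → ℕ→ℚ (n C k) * (product k + product (suc k))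
           ≡ (θ-term k + x * ∂-term k) + (term-θ k + x * term-∂ k)
    expand k k≤n = begin
        ℕ→ℚ (n C k) * (geometric (suc n ∸ k) a * geometric k b + geometric (n ∸ k) a * geometric (suc k) b)
      ≡⟨ cong (λ m → ℕ→ℚ (n C k) * (geometric m a * geometric k b + geometric (n ∸ k) a * geometric (suc k) b))
              (ℕ.+-∸-assoc 1 k≤n) ⟩
        ℕ→ℚ (n C k) * (geometric (suc (n ∸ k)) a * geometric k b + geometric (n ∸ k) a * geometric (suc k) b)
      ≡⟨ cong₂ (λ u v → ℕ→ℚ (n C k) * (u * geometric k b + geometric (n ∸ k) a * v))
               (geometric-suc (n ∸ k) a) (geometric-suc k b) ⟩
        ℕ→ℚ (n C k) * ((geometric (n ∸ k) (θ a) + x * geometric (n ∸ k) (∂ a)) * geometric k b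
                      + geometric (n ∸ k) a * (geometric k (θ b) + x * geometric k (∂ b)))
      ≡⟨ distribute x (ℕ→ℚ (n C k)) (geometric (n ∸ k) (θ a)) (geometric (n ∸ k) (∂ a)) (geometric k b)
                    (geometric (n ∸ k) a) (geometric k (θ b)) (geometric k (∂ b)) ⟩
        (θ-term k + x * ∂-term k) + (term-θ k + x * term-∂ k)
      ∎

  binomialConvolution≡geometric-⋆ : ∀ n a b → binomialConvolution n a b ≡ geometric n (a ⋆ b)
  binomialConvolution≡geometric-⋆ zero a b =
    solve 2 (λ u v → con 1ℚ :* (con 1ℚ :* u :* con 1ℚ) :* (con 1ℚ :* v :* con 1ℚ)
                  := con 1ℚ :* (u :* v) :* con 1ℚ) refl (a 0) (b 0)
  binomialConvolution≡geometric-⋆ (suc n) a b = begin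
      binomialConvolution (suc n) a b
    ≡⟨ binomialConvolution-suc n a b ⟩
      (binomialConvolution n (θ a) b + x * binomialConvolution n (∂ a) b)
        + (binomialConvolution n a (θ b) + x * binomialConvolution n a (∂ b))
    ≡⟨ cong₂ _+_ (cong₂ (λ u v → u + x * v) (IH (θ a) b) (IH (∂ a) b))
                 (cong₂ (λ u v → u + x * v) (IH a (θ b)) (IH a (∂ b))) ⟩
      (geometric n (θ a ⋆ b) + x * geometric n (∂ a ⋆ b)) + (geometric n (a ⋆ θ b) + x * geometric n (a ⋆ ∂ b))
    ≡⟨ regroup x (geometric n (θ a ⋆ b)) (geometric n (∂ a ⋆ b))
                 (geometric n (a ⋆ θ b)) (geometric n (a ⋆ ∂ b)) ⟩
      (geometric n (θ a ⋆ b) + geometric n (a ⋆ θ b)) + x * (geometric n (∂ a ⋆ b) + geometric n (a ⋆ ∂ b))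
    ≡⟨ cong₂ (λ u v → u + x * v) (geometric-⊕ n (θ a ⋆ b) (a ⋆ θ b)) (geometric-⊕ n (∂ a ⋆ b) (a ⋆ ∂ b)) ⟨
      geometric n (θ a ⋆ b ⊕ a ⋆ θ b) + x * geometric n (∂ a ⋆ b ⊕ a ⋆ ∂ b)
    ≡⟨ cong₂ (λ u v → u + x * v) (geometric-cong n (θ-⋆ a b)) (geometric-cong n (∂-⋆ a b)) ⟨
      geometric n (θ (a ⋆ b)) + x * geometric n (∂ (a ⋆ b))
    ≡⟨ geometric-suc n (a ⋆ b) ⟨
      geometric (suc n) (a ⋆ b)
    ∎
    where
    IH : ∀ a b → binomialConvolution n a b ≡ geometric n (a ⋆ b)
    IH = binomialConvolution≡geometric-⋆ n
    regroup : ∀ y p q r s → (p + y * q) + (r + y * s) ≡ (p + r) + y * (q + s)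
    regroup = solve 5 (λ y p q r s → (p :+ y :* q) :+ (r :+ y :* s) := (p :+ r) :+ y :* (q :+ s)) refl

mutual
  θ-harmonic : ∀ j → (θ harmonic ⊕ harmonic) j ≡ (harmonic ⋆ const 1ℚ ⊕ θ (const 1ℚ)) j
  θ-harmonic zero    = refl
  θ-harmonic (suc j) = begin
      ∂ harmonic j + harmonic (suc j)
    ≡⟨ cong (_+ harmonic (suc j)) (∂-harmonic j) ⟩
      ((harmonic ⋆ const 1ℚ) j + ∂ (const 1ℚ) j) + harmonic (suc j)
    ≡⟨ regroup ((harmonic ⋆ const 1ℚ) j) (∂ (const 1ℚ) j) (harmonic (suc j)) ⟩
      (harmonic ⋆ const 1ℚ) (suc j) + θ (const 1ℚ) (suc j)
    ∎
    where
    regroup : ∀ s t h → (s + t) + h ≡ (s + h * 1ℚ) + t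
    regroup = solve 3 (λ s t h → (s :+ t) :+ h := (s :+ h :* con 1ℚ) :+ t) refl

  ∂-harmonic : ∀ j → ∂ harmonic j ≡ (harmonic ⋆ const 1ℚ ⊕ ∂ (const 1ℚ)) j
  ∂-harmonic j = begin
      ℕ→ℚ (suc j) * (harmonic j + (ℤ.+ 1) / suc j)
    ≡⟨ *-distribˡ-+ (ℕ→ℚ (suc j)) (harmonic j) ((ℤ.+ 1) / suc j) ⟩
      ℕ→ℚ (suc j) * harmonic j + ℕ→ℚ (suc j) * ((ℤ.+ 1) / suc j)
    ≡⟨ cong₂ _+_ (cong (_* harmonic j) (ℕ→ℚ-+ 1 j)) (ℕ→ℚ[1+n]*1/[1+n]≡1 j) ⟩
      (1ℚ + ℕ→ℚ j) * harmonic j + 1ℚ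
    ≡⟨ cong (_+ 1ℚ) (expand (ℕ→ℚ j) (harmonic j)) ⟩
      (θ harmonic j + harmonic j) + 1ℚ
    ≡⟨ cong (_+ 1ℚ) (θ-harmonic j) ⟩
      ((harmonic ⋆ const 1ℚ) j + ℕ→ℚ j * 1ℚ) + 1ℚ
    ≡⟨ regroup ((harmonic ⋆ const 1ℚ) j) (ℕ→ℚ j) ⟩
      (harmonic ⋆ const 1ℚ) j + (1ℚ + ℕ→ℚ j) * 1ℚ
    ≡⟨ cong (λ m → (harmonic ⋆ const 1ℚ) j + m * 1ℚ) (ℕ→ℚ-+ 1 j) ⟨
      (harmonic ⋆ const 1ℚ) j + ∂ (const 1ℚ) j
    ∎
    where
    expand : ∀ m h → (1ℚ + m) * h ≡ m * h + h
    expand = solve 2 (λ m h → (con 1ℚ :+ m) :* h := m :* h :+ h) refl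
    regroup : ∀ s m → (s + m * 1ℚ) + 1ℚ ≡ s + (1ℚ + m) * 1ℚ
    regroup = solve 2 (λ s m → (s :+ m :* con 1ℚ) :+ con 1ℚ := s :+ (con 1ℚ :+ m) :* con 1ℚ) refl

Hw≡geometric : ∀ m x → Hw m x ≡ geometric x m harmonic
Hw≡geometric m x = sym (sumTo≡sumFrom1 m (trans (cong (_* 1ℚ) (*-zeroʳ (surj m 0))) (*-zeroˡ 1ℚ)))

w≡geometric : ∀ m x → w m x ≡ geometric x m (const 1ℚ)
w≡geometric m x = sumTo-cong m (λ k _ → cong (_* x ^ k) (sym (*-identityʳ (surj m k))))

Hw-suc+Hw : ∀ n x → Hw (suc n) x + Hw n x ≡ (x + 1ℚ) * geometric x n (harmonic ⋆ const 1ℚ) + w (suc n) x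
Hw-suc+Hw n x = begin
    Hw (suc n) x + Hw n x
  ≡⟨ cong₂ _+_ (trans (Hw≡geometric (suc n) x) (geometric-suc x n harmonic)) (Hw≡geometric n x) ⟩
    (g (θ harmonic) + x * g (∂ harmonic)) + g harmonic
  ≡⟨ trans (regroup x (g (θ harmonic)) (g (∂ harmonic)) (g harmonic))
           (cong (_+ x * g (∂ harmonic)) (sym (geometric-⊕ x n (θ harmonic) harmonic))) ⟩
    g (θ harmonic ⊕ harmonic) + x * g (∂ harmonic)
  ≡⟨ cong₂ (λ u v → u + x * v) (geometric-cong x n θ-harmonic) (geometric-cong x n ∂-harmonic) ⟩
    g (harmonic ⋆ const 1ℚ ⊕ θ (const 1ℚ)) + x * g (harmonic ⋆ const 1ℚ ⊕ ∂ (const 1ℚ))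
  ≡⟨ cong₂ (λ u v → u + x * v) (geometric-⊕ x n (harmonic ⋆ const 1ℚ) (θ (const 1ℚ)))
                               (geometric-⊕ x n (harmonic ⋆ const 1ℚ) (∂ (const 1ℚ))) ⟩
    (g (harmonic ⋆ const 1ℚ) + g (θ (const 1ℚ))) + x * (g (harmonic ⋆ const 1ℚ) + g (∂ (const 1ℚ)))
  ≡⟨ factor x (g (harmonic ⋆ const 1ℚ)) (g (θ (const 1ℚ))) (g (∂ (const 1ℚ))) ⟩
    (x + 1ℚ) * g (harmonic ⋆ const 1ℚ) + (g (θ (const 1ℚ)) + x * g (∂ (const 1ℚ)))
  ≡⟨ cong ((x + 1ℚ) * g (harmonic ⋆ const 1ℚ) +_)
          (trans (w≡geometric (suc n) x) (geometric-suc x n (const 1ℚ))) ⟨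
    (x + 1ℚ) * g (harmonic ⋆ const 1ℚ) + w (suc n) x
  ∎
  where
  g : Seq → ℚ
  g = geometric x n
  regroup : ∀ y p q h → (p + y * q) + h ≡ (p + h) + y * q
  regroup = solve 4 (λ y p q h → (p :+ y :* q) :+ h := (p :+ h) :+ y :* q) refl
  factor : ∀ y c p q → (c + p) + y * (c + q) ≡ (y + 1ℚ) * c + (p + y * q)
  factor = solve 4 (λ y c p q → (c :+ p) :+ y :* (c :+ q) := (y :+ con 1ℚ) :* c :+ (p :+ y :* q)) refl

lemma1 : (n : ℕ) (x : ℚ) →
    (x + 1ℚ) * sumTo n (λ k → ℕ→ℚ (n C k) * Hw (n ∸ k) x * w k x)
      ≡ Hw (suc n) x + Hw n x - w (suc n) x
lemma1 n x = begin
    (x + 1ℚ) * sumTo n (λ k → ℕ→ℚ (n C k) * Hw (n ∸ k) x * w k x)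
  ≡⟨ cong ((x + 1ℚ) *_) binomial ⟩
    (x + 1ℚ) * geometric x n (harmonic ⋆ const 1ℚ)
  ≡⟨ p≡p+q-q ((x + 1ℚ) * geometric x n (harmonic ⋆ const 1ℚ)) (w (suc n) x) ⟩
    (x + 1ℚ) * geometric x n (harmonic ⋆ const 1ℚ) + w (suc n) x - w (suc n) x
  ≡⟨ cong (_- w (suc n) x) (Hw-suc+Hw n x) ⟨
    Hw (suc n) x + Hw n x - w (suc n) x
  ∎
  where
  binomial : sumTo n (λ k → ℕ→ℚ (n C k) * Hw (n ∸ k) x * w k x) ≡ geometric x n (harmonic ⋆ const 1ℚ)
  binomial = trans (sumTo-cong n (λ k _ → cong₂ (λ u v → ℕ→ℚ (n C k) * u * v)
                                                (Hw≡geometric (n ∸ k) x) (w≡geometric k x)))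
                   (binomialConvolution≡geometric-⋆ x n harmonic (const 1ℚ))
  p≡p+q-q : ∀ p q → p ≡ p + q - q
  p≡p+q-q = solve 2 (λ p q → p := p :+ q :- q) refl
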